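{- Let $\mathcal{O}$ be an order in an imaginary quadratic field with discriminant $\Delta_{\mathcal{O}}$, and let $N(\mathcal{O})=\{N(\lambda):\lambda\in\mathcal{O}\}$ be its image under the norm map. Let $m>2$ be an integer. If the reduction of $N(\mathcal{O})$ modulo $m$ is contained in $\{x^2: x\in\mathbb{Z}/m\mathbb{Z}\}$, then $\gcd(m,\Delta_{\mathcal{O}})>1$. -}

module Defs where

open import Data.Nat using (ℕ)
open import Data.Integer using (ℤ; +_; _+_; _-_; _*_; _<_; _%_; _/ℕ_)
open import Data.Product using (_×_)
open import Data.Sum using (_⊎_)
open import Relation.Binary.PropositionalEquality using (_≡_)

-- An order O in an imaginary quadratic field is determined by its
-- discriminant Δ, an integer with Δ < 0 and Δ ≡ 0 or 1 (mod 4):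
--   O = ℤ[ω],  ω = (Δ + √Δ)/2,  so O = { x + y ω : x y ∈ ℤ }.
record ImagQuadOrder : Set where
  field
    disc     : ℤ
    disc<0   : disc < + 0
    disc≡0,1 : (disc % + 4 ≡ 0) ⊎ (disc % + 4 ≡ 1)

open ImagQuadOrder public

-- Elements of O, written x + y ω.
Elt : ImagQuadOrder → Set
Elt _ = ℤ × ℤ

-- Trace and norm of ω: ω + ω̄ = Δ and ω ω̄ = (Δ² − Δ)/4 (exact division).
trω : ImagQuadOrder → ℤ
trω O = disc O

nmω : ImagQuadOrder → ℤ
nmω O = (disc O * disc O - disc O) /ℕ 4

-- Norm map N(x + y ω) = (x + y ω)(x + y ω̄) = x² + Δ x y + ((Δ² − Δ)/4) y².
norm : (O : ImagQuadOrder) → ℤ → ℤ → ℤ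
norm O x y = x * x + trω O * x * y + nmω O * y * y

-- Suppose gcd(m, Δ) = 1, Δ < 0 being the discriminant of the norm form
-- N(x, y) = x² + Δxy + cy², c = (Δ² − Δ)/4.  If 4 ∣ m, then Δ is odd and
-- N(1, 2) = 1 + 2Δ + 4c ≡ 3 (mod 4) is not a square.  Otherwise m has an odd
-- divisor d = 2h + 1 ≥ 3, prime to Δ.  Completing the square,
-- 4N(x, 1) = (2x + Δ)² − Δ, and as 2 is invertible mod d, u² + |Δ| is a square
-- mod d for every u; by induction so is every multiple k|Δ|, hence, |Δ| being
-- invertible mod d, every residue.  But modulo d every square is the square of
-- one of 0, …, h, which gives only h + 1 < d squares.

module Submission where

open import Defs
open import Data.Nat using (ℕ; _<_)
open import Data.Nat.GCD using (gcd)
open import Data.Integer using (ℤ; +_; _-_; _*_; ∣_∣)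
open import Data.Integer.Divisibility using (_∣_)
open import Data.Product using (∃)

import Data.Nat as ℕ
import Data.Nat.Properties as ℕ
import Data.Nat.Divisibility as ℕ
open import Data.Nat.Coprimality using (Coprime; coprime-Bézout; gcd≡1⇒coprime)
open import Data.Nat.GCD using (module Bézout; gcd[m,n]≢0)
open import Data.Integer using (_+_; -_; _⊖_; _/_; _%_; _/ℕ_; _%ℕ_)
import Data.Integer as ℤ
import Data.Integer.Properties as ℤ
open import Data.Integer.DivMod using (a≡a%n+[a/n]*n; n%d<d; a≡a%ℕn+[a/ℕn]*n; n%ℕd<d)
open import Data.Integer.Divisibility.Signed as Signed using (divides)
open import Data.Integer.Tactic.RingSolver using (solve; solve-∀)
open import Data.Fin using (Fin; toℕ; fromℕ<)
import Data.Fin.Properties as Fin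
open import Data.List using (_∷_; [])
open import Data.Product using (_,_; _×_; proj₁; proj₂)
open import Data.Sum using (_⊎_; inj₁; inj₂)
open import Function using (_∘_)
open import Function.Definitions using (Injective)
open import Level using (0ℓ)
open import Relation.Binary.Bundles using (Setoid)
open import Relation.Binary.Structures using (IsEquivalence)
import Relation.Binary.Reasoning.Setoid
open import Relation.Binary.PropositionalEquality
  using (_≡_; refl; sym; trans; cong; subst; module ≡-Reasoning)
open import Relation.Nullary using (¬_; yes; no; contradiction)
open import Relation.Nullary.Decidable using (Dec; map′; from-no)

even-or-odd : ∀ n → ∃ λ k → n ≡ 2 ℕ.* k ⊎ n ≡ 1 ℕ.+ 2 ℕ.* k
even-or-odd 0 = 0 , inj₁ refl
even-or-odd 1 = 0 , inj₂ refl
even-or-odd (ℕ.suc (ℕ.suc n)) with even-or-odd n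
... | k , inj₁ n≡2k   = ℕ.suc k , inj₁ (trans (cong (2 ℕ.+_) n≡2k) (sym (ℕ.*-suc 2 k)))
... | k , inj₂ n≡1+2k =
  ℕ.suc k , inj₂ (trans (cong (2 ℕ.+_) n≡1+2k) (cong ℕ.suc (sym (ℕ.*-suc 2 k))))

4∣⊎odd-divisor : ∀ {m} → 2 ℕ.< m → 4 ℕ.∣ m ⊎ ∃ λ h → 1 ℕ.≤ h × 1 ℕ.+ 2 ℕ.* h ℕ.∣ m
4∣⊎odd-divisor {m} 2<m with even-or-odd m
... | 0 , inj₂ refl = contradiction 2<m λ { (ℕ.s≤s ()) }
... | ℕ.suc h , inj₂ refl = inj₂ (ℕ.suc h , ℕ.s≤s ℕ.z≤n , ℕ.∣-refl)
... | k , inj₁ refl with even-or-odd k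
...   | j , inj₁ refl = inj₁ (ℕ.divides j (trans (sym (ℕ.*-assoc 2 2 j)) (ℕ.*-comm 4 j)))
...   | 0 , inj₂ refl = contradiction 2<m λ { (ℕ.s≤s (ℕ.s≤s ())) }
...   | ℕ.suc h , inj₂ refl = inj₂ (ℕ.suc h , ℕ.s≤s ℕ.z≤n , ℕ.divides 2 refl)

-- Congruence modulo d

infix 4 _≡_[mod_]

-- A record rather than a plain definition, so that Agda can infer a and b
-- from a ≡ b [mod d ].
record _≡_[mod_] (a b : ℤ) (d : ℕ) : Set where
  constructor mod∣
  field ∣difference : + d Signed.∣ a - b

open _≡_[mod_]

infix 4 _≡?_[mod_]

_≡?_[mod_] : ∀ a b d → Dec (a ≡ b [mod d ])
a ≡? b [mod d ] = map′ mod∣ ∣difference (+ d Signed.∣? a - b)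

∣-respʳ-≡ : ∀ {k a b} → k Signed.∣ a → a ≡ b → k Signed.∣ b
∣-respʳ-≡ k∣a refl = k∣a

module _ {d : ℕ} where

  ≡⇒≡[mod] : ∀ {a b} → a ≡ b → a ≡ b [mod d ]
  ≡⇒≡[mod] {a} refl = mod∣ (divides (+ 0) (trans (ℤ.+-inverseʳ a) (sym (ℤ.*-zeroˡ (+ d)))))

  ≡[mod]-refl : ∀ {a} → a ≡ a [mod d ]
  ≡[mod]-refl = ≡⇒≡[mod] refl

  ≡[mod]-sym : ∀ {a b} → a ≡ b [mod d ] → b ≡ a [mod d ]
  ≡[mod]-sym {a} {b} (mod∣ p) = mod∣ (∣-respʳ-≡ (Signed.∣m⇒∣-m p) (solve (a ∷ b ∷ [])))

  ≡[mod]-trans : ∀ {a b c} → a ≡ b [mod d ] → b ≡ c [mod d ] → a ≡ c [mod d ]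
  ≡[mod]-trans {a} {b} {c} (mod∣ p) (mod∣ q) =
    mod∣ (∣-respʳ-≡ (Signed.∣m∣n⇒∣m+n p q) (ℤ.+-minus-telescope a b c))

  ≡[mod]-isEquivalence : IsEquivalence _≡_[mod d ]
  ≡[mod]-isEquivalence = record
    { refl = ≡[mod]-refl ; sym = ≡[mod]-sym ; trans = ≡[mod]-trans }

  ≡[mod]-setoid : Setoid 0ℓ 0ℓ
  ≡[mod]-setoid = record { isEquivalence = ≡[mod]-isEquivalence }

  +-cong[mod] : ∀ {a b a′ b′} → a ≡ a′ [mod d ] → b ≡ b′ [mod d ] → a + b ≡ a′ + b′ [mod d ]
  +-cong[mod] {a} {b} {a′} {b′} (mod∣ p) (mod∣ q) =
    mod∣ (∣-respʳ-≡ (Signed.∣m∣n⇒∣m+n p q) (solve (a ∷ b ∷ a′ ∷ b′ ∷ [])))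

  -‿cong[mod] : ∀ {a a′} → a ≡ a′ [mod d ] → - a ≡ - a′ [mod d ]
  -‿cong[mod] {a} {a′} (mod∣ p) = mod∣ (∣-respʳ-≡ (Signed.∣m⇒∣-m p) (solve (a ∷ a′ ∷ [])))

  *-cong[mod] : ∀ {a b a′ b′} → a ≡ a′ [mod d ] → b ≡ b′ [mod d ] → a * b ≡ a′ * b′ [mod d ]
  *-cong[mod] {a} {b} {a′} {b′} (mod∣ p) (mod∣ q) =
    mod∣ (∣-respʳ-≡ (Signed.∣m∣n⇒∣m+n (Signed.∣m⇒∣m*n b p) (Signed.∣n⇒∣m*n a′ q))
                    (solve (a ∷ b ∷ a′ ∷ b′ ∷ [])))

  +-congˡ[mod] : ∀ k {a b} → a ≡ b [mod d ] → k + a ≡ k + b [mod d ]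
  +-congˡ[mod] k = +-cong[mod] (≡[mod]-refl {k})

  +-congʳ[mod] : ∀ k {a b} → a ≡ b [mod d ] → a + k ≡ b + k [mod d ]
  +-congʳ[mod] k a≡b = +-cong[mod] a≡b (≡[mod]-refl {k})

  *-congˡ[mod] : ∀ k {a b} → a ≡ b [mod d ] → k * a ≡ k * b [mod d ]
  *-congˡ[mod] k = *-cong[mod] (≡[mod]-refl {k})

  *-congʳ[mod] : ∀ k {a b} → a ≡ b [mod d ] → a * k ≡ b * k [mod d ]
  *-congʳ[mod] k a≡b = *-cong[mod] a≡b (≡[mod]-refl {k})

  +*d≡[mod] : ∀ r k → r + k * + d ≡ r [mod d ]
  +*d≡[mod] r k = mod∣ (divides k (r+x-r≡x r (k * + d)))
    where
    r+x-r≡x : ∀ r x → r + x - r ≡ x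
    r+x-r≡x = solve-∀

  ≡[mod]-% : ∀ a .{{_ : ℕ.NonZero d}} → a ≡ + (a % + d) [mod d ]
  ≡[mod]-% a =
    ≡[mod]-trans (≡⇒≡[mod] (a≡a%n+[a/n]*n a (+ d))) (+*d≡[mod] (+ (a % + d)) (a / + d))

  ≡[mod]-∣ : ∀ {m a b} → d ℕ.∣ m → a ≡ b [mod m ] → a ≡ b [mod d ]
  ≡[mod]-∣ d∣m (mod∣ p) = mod∣ (Signed.∣-trans (Signed.∣ᵤ⇒∣ d∣m) p)

module ≡[mod]-Reasoning (d : ℕ) = Relation.Binary.Reasoning.Setoid (≡[mod]-setoid {d})

≡0[mod]⇒∣ : ∀ {d a} → a ≡ + 0 [mod d ] → d ℕ.∣ ∣ a ∣
≡0[mod]⇒∣ {a = a} (mod∣ d∣a-0) = Signed.∣⇒∣ᵤ (∣-respʳ-≡ d∣a-0 (ℤ.+-identityʳ a))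

odd⇒≡1[mod2] : ∀ {a} → ¬ 2 ℕ.∣ ∣ a ∣ → a ≡ + 1 [mod 2 ]
odd⇒≡1[mod2] {a} 2∤a with a % + 2 | ≡[mod]-% {2} a | n%d<d a (+ 2)
... | 0 | a≡0 | _ = contradiction (≡0[mod]⇒∣ a≡0) 2∤a
... | 1 | a≡1 | _ = a≡1
... | ℕ.suc (ℕ.suc _) | _ | ℕ.s≤s (ℕ.s≤s ())

≡[mod]-complement : ∀ {d r} → r ℕ.≤ d → + r ≡ - + (d ℕ.∸ r) [mod d ]
≡[mod]-complement {d} {r} r≤d = mod∣ (divides (+ 1) (begin
  + r - - + (d ℕ.∸ r)   ≡⟨ cong (_+_ (+ r)) (ℤ.neg-involutive (+ (d ℕ.∸ r))) ⟩
  + (r ℕ.+ (d ℕ.∸ r))   ≡⟨ cong +_ (ℕ.m+[n∸m]≡n r≤d) ⟩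
  + d                   ≡⟨ ℤ.*-identityˡ (+ d) ⟨
  + 1 * + d             ∎))
  where open ≡-Reasoning

+*≡⇒≡[mod] : ∀ {d} a x {b} → a ℕ.+ x ℕ.* d ≡ b → + b ≡ + a [mod d ]
+*≡⇒≡[mod] {d} a x {b} a+xd≡b = begin
  + b               ≡⟨ cong +_ a+xd≡b ⟨
  + a + + (x ℕ.* d) ≡⟨ cong (_+_ (+ a)) (ℤ.pos-* x d) ⟩
  + a + + x * + d   ≈⟨ +*d≡[mod] (+ a) (+ x) ⟩
  + a               ∎
  where open ≡[mod]-Reasoning d

+≡*⇒≡-[mod] : ∀ {d} a {b} x → a ℕ.+ b ≡ x ℕ.* d → + b ≡ - + a [mod d ]
+≡*⇒≡-[mod] {d} a {b} x a+b≡xd = mod∣ (divides (+ x) (begin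
  + b - - + a       ≡⟨ cong (_+_ (+ b)) (ℤ.neg-involutive (+ a)) ⟩
  + (b ℕ.+ a)       ≡⟨ cong +_ (trans (ℕ.+-comm b a) a+b≡xd) ⟩
  + (x ℕ.* d)       ≡⟨ ℤ.pos-* x d ⟩
  + x * + d         ∎))
  where open ≡-Reasoning

coprime⇒inverse[mod] : ∀ {d n} → Coprime d n → ∃ λ k → + k * + n ≡ + 1 [mod d ]
coprime⇒inverse[mod] {d} {n} cop with coprime-Bézout cop
... | Bézout.-+ x y 1+xd≡yn =
  y , ≡[mod]-trans (≡⇒≡[mod] (sym (ℤ.pos-* y n))) (+*≡⇒≡[mod] 1 x 1+xd≡yn)
... | Bézout.+- x y 1+yn≡xd = y ℕ.* (y ℕ.* n) , (begin
  + (y ℕ.* (y ℕ.* n)) * + n ≡⟨ cong (_* + n) (trans (ℤ.pos-* y _) (cong (+ y *_) (ℤ.pos-* y n))) ⟩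
  + y * (+ y * + n) * + n   ≡⟨ a[ab]b≡[ab][ab] (+ y) (+ n) ⟩
  + y * + n * (+ y * + n)   ≈⟨ *-cong[mod] yn≡-1 yn≡-1 ⟩
  + 1                       ∎)
  where
  open ≡[mod]-Reasoning d
  a[ab]b≡[ab][ab] : ∀ a b → a * (a * b) * b ≡ a * b * (a * b)
  a[ab]b≡[ab][ab] = solve-∀
  yn≡-1 : + y * + n ≡ - + 1 [mod d ]
  yn≡-1 = ≡[mod]-trans (≡⇒≡[mod] (sym (ℤ.pos-* y n))) (+≡*⇒≡-[mod] 1 x 1+yn≡xd)

∣∧<⇒≡0 : ∀ {d k} → d ℕ.∣ k → k ℕ.< d → k ≡ 0
∣∧<⇒≡0 {k = ℕ.zero}  _   _   = refl
∣∧<⇒≡0 {k = ℕ.suc _} d∣k k<d = contradiction d∣k (ℕ.>⇒∤ k<d)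

∣[+m]-[+n]∣≡∣m-n∣ : ∀ m n → ∣ + m - + n ∣ ≡ ℕ.∣ m - n ∣
∣[+m]-[+n]∣≡∣m-n∣ m n with ℕ.≤-total m n
... | inj₁ m≤n = begin
  ∣ + m - + n ∣ ≡⟨ cong ∣_∣ (ℤ.[+m]-[+n]≡m⊖n m n) ⟩
  ∣ m ⊖ n ∣     ≡⟨ ℤ.∣⊖∣-≤ m≤n ⟩
  n ℕ.∸ m       ≡⟨ ℕ.m≤n⇒∣m-n∣≡n∸m m≤n ⟨
  ℕ.∣ m - n ∣   ∎
  where open ≡-Reasoning
... | inj₂ n≤m = begin
  ∣ + m - + n ∣ ≡⟨ cong ∣_∣ (ℤ.[+m]-[+n]≡m⊖n m n) ⟩
  ∣ m ⊖ n ∣     ≡⟨ ℤ.∣m⊖n∣≡∣n⊖m∣ m n ⟩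
  ∣ n ⊖ m ∣     ≡⟨ ℤ.∣⊖∣-≤ n≤m ⟩
  m ℕ.∸ n       ≡⟨ ℕ.m≤n⇒∣n-m∣≡n∸m n≤m ⟨
  ℕ.∣ m - n ∣   ∎
  where open ≡-Reasoning

≡[mod]⇒≡ : ∀ {d i j} → i ℕ.< d → j ℕ.< d → + i ≡ + j [mod d ] → i ≡ j
≡[mod]⇒≡ {d} {i} {j} i<d j<d (mod∣ d∣i-j) = ℕ.∣m-n∣≡0⇒m≡n (∣∧<⇒≡0 d∣∣i-j∣ ∣i-j∣<d)
  where
  d∣∣i-j∣ : d ℕ.∣ ℕ.∣ i - j ∣
  d∣∣i-j∣ = subst (d ℕ.∣_) (∣[+m]-[+n]∣≡∣m-n∣ i j) (Signed.∣⇒∣ᵤ d∣i-j)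
  ∣i-j∣<d : ℕ.∣ i - j ∣ ℕ.< d
  ∣i-j∣<d = ℕ.≤-<-trans (ℕ.∣m-n∣≤m⊔n i j) (ℕ.⊔-pres-<m i<d j<d)

[a/ℕd]*d≡a : ∀ a d .{{_ : ℕ.NonZero d}} → a ≡ + 0 [mod d ] → (a /ℕ d) * + d ≡ a
[a/ℕd]*d≡a a d a≡0 = sym (begin
  a                            ≡⟨ a≡a%ℕn+[a/ℕn]*n a d ⟩
  + (a %ℕ d) + (a /ℕ d) * + d  ≡⟨ cong (λ r → + r + (a /ℕ d) * + d) a%d≡0 ⟩
  + 0 + (a /ℕ d) * + d         ≡⟨ ℤ.+-identityˡ _ ⟩
  (a /ℕ d) * + d               ∎)
  where
  open ≡-Reasoning
  a%d≡0 : a %ℕ d ≡ 0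
  a%d≡0 = ≡[mod]⇒≡ (n%ℕd<d a d) (ℕ.>-nonZero⁻¹ d) (≡[mod]-trans (≡[mod]-sym (≡[mod]-% a)) a≡0)

-- Squares modulo d

IsSquareMod : ℕ → ℤ → Set
IsSquareMod d a = ∃ λ z → a ≡ z * z [mod d ]

IsSquareMod-resp : ∀ {d a b} → a ≡ b [mod d ] → IsSquareMod d b → IsSquareMod d a
IsSquareMod-resp a≡b (z , b≡z²) = z , ≡[mod]-trans a≡b b≡z²

IsSquareMod-∣ : ∀ {d m a} → d ℕ.∣ m → IsSquareMod m a → IsSquareMod d a
IsSquareMod-∣ d∣m (z , a≡z²) = z , ≡[mod]-∣ d∣m a≡z²

3-nonsquare-residue[mod4] : ¬ ∃ λ r → r ℕ.< 4 × + 3 ≡ + r * + r [mod 4 ]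
3-nonsquare-residue[mod4] = from-no (ℕ.anyUpTo? (λ r → + 3 ≡? + r * + r [mod 4 ]) 4)

3-nonsquare[mod4] : ¬ IsSquareMod 4 (+ 3)
3-nonsquare[mod4] (z , 3≡z²) =
  3-nonsquare-residue[mod4] (z % + 4 , n%d<d z (+ 4) , ≡[mod]-trans 3≡z² (*-cong[mod] z≡r z≡r))
  where
  z≡r : z ≡ + (z % + 4) [mod 4 ]
  z≡r = ≡[mod]-% z

residue²≡square-of-half : ∀ h {R} → R ℕ.< 1 ℕ.+ 2 ℕ.* h →
  ∃ λ r → r ℕ.≤ h × + R * + R ≡ + r * + r [mod 1 ℕ.+ 2 ℕ.* h ]
residue²≡square-of-half h {R} R<d with R ℕ.≤? h
... | yes R≤h = R , R≤h , ≡[mod]-refl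
... | no R≰h = d ℕ.∸ R , d-R≤h , (begin
  + R * + R                     ≈⟨ *-cong[mod] R≡-r R≡-r ⟩
  - + (d ℕ.∸ R) * - + (d ℕ.∸ R) ≡⟨ -a*-a≡a*a (+ (d ℕ.∸ R)) ⟩
  + (d ℕ.∸ R) * + (d ℕ.∸ R)     ∎)
  where
  d : ℕ
  d = 1 ℕ.+ 2 ℕ.* h
  open ≡[mod]-Reasoning d
  R≡-r : + R ≡ - + (d ℕ.∸ R) [mod d ]
  R≡-r = ≡[mod]-complement (ℕ.<⇒≤ R<d)
  -a*-a≡a*a : ∀ a → - a * - a ≡ a * a
  -a*-a≡a*a = solve-∀
  d-R≤h : d ℕ.∸ R ℕ.≤ h
  d-R≤h = ℕ.≤-trans (ℕ.∸-monoʳ-≤ d (ℕ.≰⇒> R≰h))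
                    (ℕ.≤-reflexive (trans (ℕ.m+n∸m≡n h (h ℕ.+ 0)) (ℕ.+-identityʳ h)))

square≡square-of-half : ∀ h z → ∃ λ r → r ℕ.≤ h × z * z ≡ + r * + r [mod 1 ℕ.+ 2 ℕ.* h ]
square≡square-of-half h z with residue²≡square-of-half h (n%d<d z (+ (1 ℕ.+ 2 ℕ.* h)))
... | r , r≤h , R²≡r² = r , r≤h , ≡[mod]-trans (*-cong[mod] z≡R z≡R) R²≡r²
  where
  z≡R : z ≡ + (z % + (1 ℕ.+ 2 ℕ.* h)) [mod 1 ℕ.+ 2 ℕ.* h ]
  z≡R = ≡[mod]-% z

¬all-squares-mod-odd : ∀ {h} → 1 ℕ.≤ h → ¬ (∀ i → IsSquareMod (1 ℕ.+ 2 ℕ.* h) (+ i))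
¬all-squares-mod-odd {h} 1≤h sq = ℕ.<⇒≱ 1+h<d (Fin.injective⇒≤ half-root-injective)
  where
  d : ℕ
  d = 1 ℕ.+ 2 ℕ.* h

  half-root : ∀ i → ∃ λ r → r ℕ.≤ h × + i ≡ + r * + r [mod d ]
  half-root i with sq i
  ... | z , i≡z² with square≡square-of-half h z
  ...   | r , r≤h , z²≡r² = r , r≤h , ≡[mod]-trans i≡z² z²≡r²

  half-root-fin : Fin d → Fin (ℕ.suc h)
  half-root-fin i = fromℕ< (ℕ.s≤s (proj₁ (proj₂ (half-root (toℕ i)))))

  half-root-injective : Injective _≡_ _≡_ half-root-fin
  half-root-injective {i} {j} ri≡rj = Fin.toℕ-injective
    (≡[mod]⇒≡ (Fin.toℕ<n i) (Fin.toℕ<n j) (begin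
      + toℕ i     ≈⟨ proj₂ (proj₂ (half-root (toℕ i))) ⟩
      + rᵢ * + rᵢ ≡⟨ cong (λ r → + r * + r) rᵢ≡rⱼ ⟩
      + rⱼ * + rⱼ ≈⟨ ≡[mod]-sym (proj₂ (proj₂ (half-root (toℕ j)))) ⟩
      + toℕ j     ∎))
    where
    open ≡[mod]-Reasoning d
    rᵢ rⱼ : ℕ
    rᵢ = proj₁ (half-root (toℕ i))
    rⱼ = proj₁ (half-root (toℕ j))
    rᵢ≡rⱼ : rᵢ ≡ rⱼ
    rᵢ≡rⱼ = trans (sym (Fin.toℕ-fromℕ< _)) (trans (cong toℕ ri≡rj) (Fin.toℕ-fromℕ< _))

  1+h<d : ℕ.suc h ℕ.< d
  1+h<d = ℕ.s≤s (subst (h ℕ.<_) (cong (h ℕ.+_) (sym (ℕ.+-identityʳ h))) (ℕ.m<m+n h 1≤h))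

2*[1+h]≡1[mod1+2h] : ∀ h → + 2 * + ℕ.suc h ≡ + 1 [mod 1 ℕ.+ 2 ℕ.* h ]
2*[1+h]≡1[mod1+2h] h = mod∣ (divides (+ 1) (begin
  + 2 * + ℕ.suc h - + 1          ≡⟨ cong (_- + 1) (ℤ.pos-* 2 (ℕ.suc h)) ⟨
  + (2 ℕ.* ℕ.suc h) - + 1        ≡⟨ cong (λ n → + n - + 1) (ℕ.*-suc 2 h) ⟩
  + (2 ℕ.+ 2 ℕ.* h) - + 1        ≡⟨⟩
  + (1 ℕ.+ 2 ℕ.* h)              ≡⟨ ℤ.*-identityˡ _ ⟨
  + 1 * + (1 ℕ.+ 2 ℕ.* h)        ∎))
  where open ≡-Reasoning

multiples-squares : ∀ {d a} → (∀ u → IsSquareMod d (u * u + a)) → ∀ k → IsSquareMod d (+ k * a)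
multiples-squares sq ℕ.zero = + 0 , ≡[mod]-refl
multiples-squares {d} {a} sq (ℕ.suc k) with multiples-squares sq k
... | w , ka≡w² = IsSquareMod-resp (begin
  + ℕ.suc k * a ≡⟨ ℤ.suc-* (+ k) a ⟩
  a + + k * a   ≈⟨ +-congˡ[mod] a ka≡w² ⟩
  a + w * w     ≡⟨ ℤ.+-comm a (w * w) ⟩
  w * w + a     ∎) (sq w)
  where open ≡[mod]-Reasoning d

residues-squares : ∀ {d n} → Coprime d n →
  (∀ k → IsSquareMod d (+ k * + n)) → ∀ i → IsSquareMod d (+ i)
residues-squares {d} {n} cop sq i with coprime⇒inverse[mod] cop
... | k , kn≡1 = IsSquareMod-resp (begin
  + i                 ≡⟨ ℤ.*-identityʳ (+ i) ⟨
  + i * + 1           ≈⟨ *-congˡ[mod] (+ i) (≡[mod]-sym kn≡1) ⟩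
  + i * (+ k * + n)   ≡⟨ ℤ.*-assoc (+ i) (+ k) (+ n) ⟨
  + i * + k * + n     ≡⟨ cong (_* + n) (ℤ.pos-* i k) ⟨
  + (i ℕ.* k) * + n   ∎) (sq (i ℕ.* k))
  where open ≡[mod]-Reasoning d

-- Binary quadratic forms

-- norm O is definitionally form (disc O) (nmω O).
form : ℤ → ℤ → ℤ → ℤ → ℤ
form b c x y = x * x + b * x * y + c * y * y

form-at-1,2≡3[mod4] : ∀ b c → b ≡ + 1 [mod 2 ] → form b c (+ 1) (+ 2) ≡ + 3 [mod 4 ]
form-at-1,2≡3[mod4] b c (mod∣ (divides q b-1≡q*2)) = mod∣ (divides (q + c) (begin
  form b c (+ 1) (+ 2) - + 3                      ≡⟨⟩
  + 1 * + 1 + b * + 1 * + 2 + c * + 2 * + 2 - + 3 ≡⟨ solve (b ∷ c ∷ []) ⟩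
  (b - + 1) * + 2 + c * + 4                       ≡⟨ cong (λ t → t * + 2 + c * + 4) b-1≡q*2 ⟩
  q * + 2 * + 2 + c * + 4                         ≡⟨ solve (q ∷ c ∷ []) ⟩
  (q + c) * + 4                                   ∎))
  where open ≡-Reasoning

form-nonsquare-mod-4 : ∀ b c → ¬ 2 ℕ.∣ ∣ b ∣ → ¬ (∀ x y → IsSquareMod 4 (form b c x y))
form-nonsquare-mod-4 b c b-odd sq = 3-nonsquare[mod4]
  (IsSquareMod-resp (≡[mod]-sym (form-at-1,2≡3[mod4] b c (odd⇒≡1[mod2] b-odd))) (sq (+ 1) (+ 2)))

completing-the-square : ∀ b c x →
  + 4 * form b c x (+ 1) ≡ (+ 2 * x + b) * (+ 2 * x + b) - (b * b - + 4 * c)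
completing-the-square b c x = begin
  + 4 * form b c x (+ 1)                      ≡⟨⟩
  + 4 * (x * x + b * x * + 1 + c * + 1 * + 1) ≡⟨ solve (b ∷ c ∷ x ∷ []) ⟩
  (+ 2 * x + b) * (+ 2 * x + b) - (b * b - + 4 * c) ∎
  where open ≡-Reasoning

square-minus-discriminant : ∀ {d} b c t → + 2 * t ≡ + 1 [mod d ] →
  (∀ x → IsSquareMod d (form b c x (+ 1))) →
  ∀ u → IsSquareMod d (u * u - (b * b - + 4 * c))
square-minus-discriminant {d} b c t 2t≡1 sq u with sq (t * (u - b))
... | z , fx≡z² = + 2 * z , (begin
  u * u - D                         ≈⟨ +-congʳ[mod] (- D) (*-cong[mod] u≡2x+b u≡2x+b) ⟩
  (+ 2 * x + b) * (+ 2 * x + b) - D ≡⟨ completing-the-square b c x ⟨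
  + 4 * form b c x (+ 1)            ≈⟨ *-congˡ[mod] (+ 4) fx≡z² ⟩
  + 4 * (z * z)                     ≡⟨ solve (z ∷ []) ⟩
  + 2 * z * (+ 2 * z)               ∎)
  where
  open ≡[mod]-Reasoning d
  D x : ℤ
  D = b * b - + 4 * c
  x = t * (u - b)
  u≡2x+b : u ≡ + 2 * x + b [mod d ]
  u≡2x+b = begin
    u                       ≡⟨ solve (u ∷ b ∷ []) ⟩
    + 1 * (u - b) + b       ≈⟨ +-congʳ[mod] b (*-congʳ[mod] (u - b) (≡[mod]-sym 2t≡1)) ⟩
    + 2 * t * (u - b) + b   ≡⟨ cong (_+ b) (ℤ.*-assoc (+ 2) t (u - b)) ⟩
    + 2 * (t * (u - b)) + b ∎

form-nonsquare-mod-odd : ∀ {h} b c n → 1 ℕ.≤ h → Coprime (1 ℕ.+ 2 ℕ.* h) n →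
  - (b * b - + 4 * c) ≡ + n → ¬ (∀ x y → IsSquareMod (1 ℕ.+ 2 ℕ.* h) (form b c x y))
form-nonsquare-mod-odd {h} b c n 1≤h cop -D≡n sq = ¬all-squares-mod-odd 1≤h
  (residues-squares cop
    (subst (λ a → ∀ k → IsSquareMod _ (+ k * a)) -D≡n
      (multiples-squares
        (square-minus-discriminant b c (+ ℕ.suc h) (2*[1+h]≡1[mod1+2h] h) (λ x → sq x (+ 1))))))

-- The norm form of an order

Δ²-Δ≡0[mod4] : ∀ Δ → Δ % + 4 ≡ 0 ⊎ Δ % + 4 ≡ 1 → Δ * Δ - Δ ≡ + 0 [mod 4 ]
Δ²-Δ≡0[mod4] Δ r≡0∨1 = begin
  Δ * Δ - Δ       ≈⟨ +-cong[mod] (*-cong[mod] Δ≡r Δ≡r) (-‿cong[mod] Δ≡r) ⟩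
  + r * + r - + r ≡⟨ r²-r≡0 r≡0∨1 ⟩
  + 0             ∎
  where
  open ≡[mod]-Reasoning 4
  r : ℕ
  r = Δ % + 4
  Δ≡r : Δ ≡ + r [mod 4 ]
  Δ≡r = ≡[mod]-% Δ
  r²-r≡0 : ∀ {r} → r ≡ 0 ⊎ r ≡ 1 → + r * + r - + r ≡ + 0
  r²-r≡0 (inj₁ refl) = refl
  r²-r≡0 (inj₂ refl) = refl

discriminant-of-norm-form : ∀ Δ → Δ % + 4 ≡ 0 ⊎ Δ % + 4 ≡ 1 →
  Δ * Δ - + 4 * ((Δ * Δ - Δ) /ℕ 4) ≡ Δ
discriminant-of-norm-form Δ r≡0∨1 = begin
  Δ * Δ - + 4 * ((Δ * Δ - Δ) /ℕ 4) ≡⟨ cong (_-_ (Δ * Δ)) 4c≡Δ²-Δ ⟩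
  Δ * Δ - (Δ * Δ - Δ)              ≡⟨ solve (Δ ∷ []) ⟩
  Δ                                ∎
  where
  open ≡-Reasoning
  4c≡Δ²-Δ : + 4 * ((Δ * Δ - Δ) /ℕ 4) ≡ Δ * Δ - Δ
  4c≡Δ²-Δ = trans (ℤ.*-comm (+ 4) _) ([a/ℕd]*d≡a _ 4 (Δ²-Δ≡0[mod4] Δ r≡0∨1))

i<0⇒-i≡+∣i∣ : ∀ {i} → i ℤ.< + 0 → - i ≡ + ∣ i ∣
i<0⇒-i≡+∣i∣ {ℤ.-[1+ _ ]} _ = refl
i<0⇒-i≡+∣i∣ {+ _} (ℤ.+<+ ())

-discriminant≡∣disc∣ : (O : ImagQuadOrder) → - (disc O * disc O - + 4 * nmω O) ≡ + ∣ disc O ∣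
-discriminant≡∣disc∣ O =
  trans (cong -_ (discriminant-of-norm-form (disc O) (disc≡0,1 O))) (i<0⇒-i≡+∣i∣ (disc<0 O))

lemma1 : (O : ImagQuadOrder) (m : ℕ) → 2 < m →
    (∀ (x y : ℤ) → ∃ λ (z : ℤ) → (+ m) ∣ (norm O x y - z * z)) →
    1 < gcd m ∣ disc O ∣
lemma1 O m 2<m H = ℕ.≤∧≢⇒< gcd>0 (not-coprime ∘ gcd≡1⇒coprime ∘ sym)
  where
  gcd>0 : 0 < gcd m ∣ disc O ∣
  gcd>0 = ℕ.n≢0⇒n>0 (gcd[m,n]≢0 m ∣ disc O ∣ (inj₁ (ℕ.m<n⇒n≢0 2<m)))

  norms-squares : ∀ x y → IsSquareMod m (norm O x y)
  norms-squares x y with H x y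
  ... | z , m∣N-z² = z , mod∣ (Signed.∣ᵤ⇒∣ m∣N-z²)

  not-coprime : ¬ Coprime m ∣ disc O ∣
  not-coprime cop with 4∣⊎odd-divisor 2<m
  ... | inj₁ 4∣m = form-nonsquare-mod-4 (disc O) (nmω O)
          (λ 2∣Δ → contradiction (cop (ℕ.∣-trans (ℕ.divides 2 refl) 4∣m , 2∣Δ)) λ ())
          (λ x y → IsSquareMod-∣ 4∣m (norms-squares x y))
  ... | inj₂ (h , 1≤h , d∣m) = form-nonsquare-mod-odd (disc O) (nmω O) ∣ disc O ∣ 1≤h
          (λ (e∣d , e∣Δ) → cop (ℕ.∣-trans e∣d d∣m , e∣Δ))
          (-discriminant≡∣disc∣ O)
          (λ x y → IsSquareMod-∣ d∣m (norms-squares x y))
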